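{- Let $G=(V,E)$ be an unweighted graph with no vertex of degree $1$, let $s,t\in V$, and let $S\subseteq V$ with $s\in S$ be a minimal minimum $s,t$-cut in $G$. Suppose $s$ has friendliness ratio less than $1/6$ with respect to $S$. Then $X=S\setminus\{s\}$ is a $\tfrac16$-friendly cut in $G$, and moreover $\mathrm{cut}_G(X)\le 2\deg(s)$.
   Context: Graphs are undirected, unweighted and simple. $\mathrm{cut}_G(S)$ is the number of edges with exactly one endpoint in $S$; a minimum $s,t$-cut is $S$ with $s\in S\subseteq V\setminus\{t\}$ minimizing $\mathrm{cut}_G(S)$. A minimum $s,t$-cut $S$ with $s\in S$ is minimal if every proper subset $S'\subsetneq S$ with $s\in S'$ has $\mathrm{cut}_G(S')>\mathrm{cut}_G(S)$. For $v\in V$, $c_v(S)$ is the number of edges incident to $v$ crossing $S$, and the friendliness ratio of $v$ is $1-c_v(S)/\deg(v)$; a cut $X$ is $\alpha$-friendly if every vertex $v\in V$ has friendliness ratio at least $\alpha$ with respect to $X$. -}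

module Defs where

open import Data.Nat using (ℕ; zero; suc; _+_; _*_; _≤_; _<_)
open import Data.Bool using (Bool; true; false; if_then_else_; _∧_; not; _xor_)
open import Data.Fin using (Fin; zero; suc)
open import Data.Fin.Subset using (Subset; _∈_; _∉_; _⊂_)
open import Data.Vec using (lookup)
open import Data.Product using (_×_)
open import Relation.Binary.PropositionalEquality using (_≡_)

record Graph (n : ℕ) : Set where
  field
    adj     : Fin n → Fin n → Bool
    sym     : ∀ u v → adj u v ≡ adj v u
    irrefl  : ∀ v → adj v v ≡ false
open Graph public

count : ∀ {n} → (Fin n → Bool) → ℕ
count {zero}  P = 0
count {suc n} P = (if P zero then 1 else 0) + count (λ i → P (suc i))

deg : ∀ {n} → Graph n → Fin n → ℕ
deg G v = count (adj G v)

cv : ∀ {n} → Graph n → Subset n → Fin n → ℕ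
cv G S v = count (λ w → adj G v w ∧ (lookup S v xor lookup S w))

sumF : ∀ {n} → (Fin n → ℕ) → ℕ
sumF {zero}  f = 0
sumF {suc n} f = f zero + sumF (λ i → f (suc i))

-- cut_G(S): number of edges with exactly one endpoint in S
-- (each such edge {u,w} counted once, as the ordered pair with u ∈ S, w ∉ S)
cut : ∀ {n} → Graph n → Subset n → ℕ
cut G S = sumF (λ u → if lookup S u
                        then count (λ w → adj G u w ∧ not (lookup S w))
                        else 0)

IsMinCut : ∀ {n : ℕ} → Graph n → Fin n → Fin n → Subset n → Set
IsMinCut {n} G s t S = s ∈ S × t ∉ S ×
  (∀ (S' : Subset n) → s ∈ S' → t ∉ S' → cut G S ≤ cut G S')

IsMinimalMinCut : ∀ {n} → Graph n → Fin n → Fin n → Subset n → Set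
IsMinimalMinCut {n} G s t S = IsMinCut G s t S ×
  (∀ (S' : Subset n) → S' ⊂ S → s ∈ S' → cut G S < cut G S')

-- friendliness ratio of v w.r.t. S is < 1/6:  1 - c/d < 1/6  ⇔  5d < 6c
FriendlinessBelowSixth : ∀ {n} → Graph n → Subset n → Fin n → Set
FriendlinessBelowSixth G S v = 5 * deg G v < 6 * cv G S v

-- friendliness ratio of v w.r.t. S is ≥ 1/6:  1 - c/d ≥ 1/6  ⇔  6c ≤ 5d
-- (for an isolated vertex, d = c = 0, this holds vacuously)
FriendlinessAtLeastSixth : ∀ {n} → Graph n → Subset n → Fin n → Set
FriendlinessAtLeastSixth G S v = 6 * cv G S v ≤ 5 * deg G v

SixthFriendly : ∀ {n} → Graph n → Subset n → Set
SixthFriendly {n} G X = ∀ (v : Fin n) → FriendlinessAtLeastSixth G X v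

{-# OPTIONS --safe #-}
-- Everything follows from moving one vertex v into a vertex set P (Q = P ∪ {v}):
--   cut Q + c_v(P) = cut P + c_v(Q)   and   deg v = c_v(P) + c_v(Q).
-- Comparing S with S − u (minimality, u ∈ S − s) and with S ∪ {u} (minimum, u ∉ S, u ≠ t)
-- shows that u has fewer than, resp. at most, half of its edges crossing S. Removing s
-- from S changes the crossing count of any u ≠ s by at most one edge, which the absence
-- of degree-1 vertices absorbs. At s itself, c_s(S − s) < deg s / 6 by unfriendliness.
-- At t, c_t(S − s) ≤ cut(S − s) ≤ 5/6 · cut S ≤ 5/6 · deg t, where the middle step uses
-- cut(S − s) = cut S + c_s(S − s) − c_s(S), cut S ≤ deg s (compare with {s}) and
-- 5 c_s(S − s) < c_s(S); the same identity gives cut(S − s) ≤ 2 deg s.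
module Submission where

open import Defs
open import Data.Bool using (Bool; true; false; if_then_else_; _∧_; not; _xor_)
open import Data.Bool.Properties using (∧-zeroʳ; ∧-identityʳ; xor-same; ¬-not)
open import Data.Fin using (Fin; zero; suc; _≟_)
open import Data.Fin.Properties using (suc-injective)
open import Data.Fin.Subset using (Subset; _∈_; _∉_; _⊂_; _-_; _∪_; ⁅_⁆; ⊥; ⊤)
open import Data.Fin.Subset.Properties
  using (_∈?_; ∉⊥; ∈⊤; x∈⁅x⁆; x∈⁅y⁆⇒x≡y; x≢y⇒x∉⁅y⁆; x∈p∪q⁺; x∈p∪q⁻; p─q⊆p; x∈p∧x≢y⇒x∈p-y; x∈p⇒p-x⊂p)
open import Data.Nat using (ℕ; zero; suc; _+_; _*_; _≤_; _<_; z≤n)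
open import Data.Nat.Properties
  using ( ≤-refl; ≤-reflexive; ≤-trans; ≤-<-trans; <⇒≤; ≤∧≢⇒<; n≤1+n; m≤m+n; m≤n+m; m≤n*m
        ; +-assoc; +-comm; +-identityʳ; *-assoc; *-distribˡ-+; *-distribʳ-+
        ; +-mono-≤; +-monoˡ-≤; +-monoʳ-≤; +-monoˡ-<; *-monoˡ-≤; *-monoʳ-≤
        ; +-cancelˡ-≤; +-cancelʳ-≤; +-cancelˡ-<; +-cancelʳ-<; module ≤-Reasoning )
open import Data.Nat.Tactic.RingSolver using (solve-∀)
open import Data.Product using (_×_; _,_; proj₁; proj₂)
open import Data.Sum using (inj₁; inj₂; [_,_]′)
open import Data.Vec using (_∷_; lookup; there)
open import Data.Vec.Properties using ([]=⇒lookup; lookup⇒[]=; lookup-replicate)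
open import Function using (_∘_; id)
open import Relation.Binary.PropositionalEquality as ≡
  using (_≡_; _≢_; refl; cong; cong₂; trans; module ≡-Reasoning)
open import Relation.Nullary using (yes; no; contradiction)

𝟙 : Bool → ℕ
𝟙 b = if b then 1 else 0

𝟙-split : ∀ a b → 𝟙 a ≡ 𝟙 (a ∧ b) + 𝟙 (a ∧ not b)
𝟙-split true  true  = refl
𝟙-split true  false = refl
𝟙-split false _     = refl

𝟙-mono : ∀ {a b} → (a ≡ true → b ≡ true) → 𝟙 a ≤ 𝟙 b
𝟙-mono {false} _   = z≤n
𝟙-mono {true}  a⇒b rewrite a⇒b refl = ≤-refl

𝟙≤1 : ∀ b → 𝟙 b ≤ 1
𝟙≤1 true  = ≤-refl
𝟙≤1 false = z≤n

sumF-cong : ∀ {n} {f g : Fin n → ℕ} → (∀ i → f i ≡ g i) → sumF f ≡ sumF g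
sumF-cong {zero}  _   = refl
sumF-cong {suc n} f≗g = cong₂ _+_ (f≗g zero) (sumF-cong (f≗g ∘ suc))

sumF-zero : ∀ {n} {f : Fin n → ℕ} → (∀ i → f i ≡ 0) → sumF f ≡ 0
sumF-zero {zero}  _   = refl
sumF-zero {suc n} f≗0 = cong₂ _+_ (f≗0 zero) (sumF-zero (f≗0 ∘ suc))

sumF-mono : ∀ {n} {f g : Fin n → ℕ} → (∀ i → f i ≤ g i) → sumF f ≤ sumF g
sumF-mono {zero}  _   = z≤n
sumF-mono {suc n} f≤g = +-mono-≤ (f≤g zero) (sumF-mono (f≤g ∘ suc))

sumF-+ : ∀ {n} (f g : Fin n → ℕ) → sumF (λ i → f i + g i) ≡ sumF f + sumF g
sumF-+ {zero}  f g = refl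
sumF-+ {suc n} f g = begin
  (f zero + g zero) + sumF (λ i → f (suc i) + g (suc i))  ≡⟨ cong (f zero + g zero +_) (sumF-+ (f ∘ suc) (g ∘ suc)) ⟩
  (f zero + g zero) + (sumF (f ∘ suc) + sumF (g ∘ suc))   ≡⟨ +-+-interchange (f zero) (g zero) _ _ ⟩
  (f zero + sumF (f ∘ suc)) + (g zero + sumF (g ∘ suc))   ∎
  where
  open ≡-Reasoning
  +-+-interchange : ∀ a b c d → (a + b) + (c + d) ≡ (a + c) + (b + d)
  +-+-interchange = solve-∀

sumF-swap-at : ∀ {n} {f g : Fin n → ℕ} (v : Fin n) →
               (∀ {i} → i ≢ v → f i ≡ g i) → sumF f + g v ≡ sumF g + f v
sumF-swap-at {suc n} {f} {g} zero f≗g = begin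
  f zero + sumF (f ∘ suc) + g zero  ≡⟨ cong (λ x → f zero + x + g zero) (sumF-cong λ i → f≗g {suc i} λ ()) ⟩
  f zero + sumF (g ∘ suc) + g zero  ≡⟨ swap-ends (f zero) _ (g zero) ⟩
  g zero + sumF (g ∘ suc) + f zero  ∎
  where
  open ≡-Reasoning
  swap-ends : ∀ a x b → a + x + b ≡ b + x + a
  swap-ends = solve-∀
sumF-swap-at {suc n} {f} {g} (suc v) f≗g = begin
  f zero + sumF (f ∘ suc) + g (suc v)    ≡⟨ +-assoc (f zero) _ _ ⟩
  f zero + (sumF (f ∘ suc) + g (suc v))  ≡⟨ cong₂ _+_ (f≗g λ ()) (sumF-swap-at v (f≗g ∘ (_∘ suc-injective))) ⟩
  g zero + (sumF (g ∘ suc) + f (suc v))  ≡⟨ +-assoc (g zero) _ _ ⟨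
  g zero + sumF (g ∘ suc) + f (suc v)    ∎
  where open ≡-Reasoning

count-sumF : ∀ {n} (P : Fin n → Bool) → count P ≡ sumF (𝟙 ∘ P)
count-sumF {zero}  P = refl
count-sumF {suc n} P = cong (𝟙 (P zero) +_) (count-sumF (P ∘ suc))

count-cong : ∀ {n} {P Q : Fin n → Bool} → (∀ i → P i ≡ Q i) → count P ≡ count Q
count-cong {zero}  _   = refl
count-cong {suc n} P≗Q = cong₂ _+_ (cong 𝟙 (P≗Q zero)) (count-cong (P≗Q ∘ suc))

count-zero : ∀ {n} {P : Fin n → Bool} → (∀ i → P i ≡ false) → count P ≡ 0
count-zero {zero}  _   = refl
count-zero {suc n} P≗0 = cong₂ _+_ (cong 𝟙 (P≗0 zero)) (count-zero (P≗0 ∘ suc))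

count-mono : ∀ {n} {P Q : Fin n → Bool} → (∀ i → P i ≡ true → Q i ≡ true) → count P ≤ count Q
count-mono {zero}  _   = z≤n
count-mono {suc n} P⇒Q = +-mono-≤ (𝟙-mono (P⇒Q zero)) (count-mono (P⇒Q ∘ suc))

count-+ : ∀ {n} {P Q R : Fin n → Bool} → (∀ i → 𝟙 (P i) ≡ 𝟙 (Q i) + 𝟙 (R i)) →
          count P ≡ count Q + count R
count-+ {P = P} {Q} {R} split = begin
  count P                            ≡⟨ count-sumF P ⟩
  sumF (𝟙 ∘ P)                       ≡⟨ sumF-cong split ⟩
  sumF (λ i → 𝟙 (Q i) + 𝟙 (R i))    ≡⟨ sumF-+ (𝟙 ∘ Q) (𝟙 ∘ R) ⟩
  sumF (𝟙 ∘ Q) + sumF (𝟙 ∘ R)       ≡⟨ cong₂ _+_ (count-sumF Q) (count-sumF R) ⟨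
  count Q + count R                  ∎
  where open ≡-Reasoning

count-swap-at : ∀ {n} {P Q : Fin n → Bool} (v : Fin n) →
                (∀ {i} → i ≢ v → P i ≡ Q i) → count P + 𝟙 (Q v) ≡ count Q + 𝟙 (P v)
count-swap-at {P = P} {Q} v P≗Q = begin
  count P + 𝟙 (Q v)        ≡⟨ cong (_+ 𝟙 (Q v)) (count-sumF P) ⟩
  sumF (𝟙 ∘ P) + 𝟙 (Q v)   ≡⟨ sumF-swap-at v (cong 𝟙 ∘ P≗Q) ⟩
  sumF (𝟙 ∘ Q) + 𝟙 (P v)   ≡⟨ cong (_+ 𝟙 (P v)) (count-sumF Q) ⟨
  count Q + 𝟙 (P v)        ∎
  where open ≡-Reasoning

𝟙≤count : ∀ {n} (P : Fin n → Bool) (v : Fin n) → 𝟙 (P v) ≤ count P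
𝟙≤count P zero    = m≤m+n (𝟙 (P zero)) _
𝟙≤count P (suc v) = ≤-trans (𝟙≤count (P ∘ suc) v) (m≤n+m _ (𝟙 (P zero)))

module _ {d y c : ℕ} where
  open ≤-Reasoning

  d≡y+c∧5d<6c⇒5y<c : d ≡ y + c → 5 * d < 6 * c → 5 * y < c
  d≡y+c∧5d<6c⇒5y<c refl 5d<6c = +-cancelʳ-< (5 * c) (5 * y) c (begin-strict
    5 * y + 5 * c  ≡⟨ *-distribˡ-+ 5 y c ⟨
    5 * (y + c)    <⟨ 5d<6c ⟩
    c + 5 * c      ∎)

  d≡y+c∧5d<6c⇒6y≤5d : d ≡ y + c → 5 * d < 6 * c → 6 * y ≤ 5 * d
  d≡y+c∧5d<6c⇒6y≤5d refl 5d<6c = begin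
    y + 5 * y      ≤⟨ +-monoˡ-≤ (5 * y) y≤5c ⟩
    5 * c + 5 * y  ≡⟨ +-comm (5 * c) (5 * y) ⟩
    5 * y + 5 * c  ≡⟨ *-distribˡ-+ 5 y c ⟨
    5 * (y + c)    ∎
    where
    y≤5c : y ≤ 5 * c
    y≤5c = begin
      y      ≤⟨ m≤n*m y 5 ⟩
      5 * y  ≤⟨ <⇒≤ (d≡y+c∧5d<6c⇒5y<c refl 5d<6c) ⟩
      c      ≤⟨ m≤n*m c 5 ⟩
      5 * c  ∎

module _ {C X y c : ℕ} where
  open ≤-Reasoning

  C+y≡X+c∧C≤d∧y≤d⇒X≤2d : ∀ {d} → C + y ≡ X + c → C ≤ d → y ≤ d → X ≤ 2 * d
  C+y≡X+c∧C≤d∧y≤d⇒X≤2d {d} C+y≡X+c C≤d y≤d = begin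
    X          ≤⟨ m≤m+n X c ⟩
    X + c      ≡⟨ C+y≡X+c ⟨
    C + y      ≤⟨ +-mono-≤ C≤d y≤d ⟩
    d + d      ≡⟨ cong (d +_) (+-identityʳ d) ⟨
    2 * d      ∎

  C+y≡X+c∧C≤y+c∧5y<c⇒6X≤5C : C + y ≡ X + c → C ≤ y + c → 5 * y < c → 6 * X ≤ 5 * C
  C+y≡X+c∧C≤y+c∧5y<c⇒6X≤5C C+y≡X+c C≤y+c 5y<c = +-cancelʳ-≤ (6 * c) (6 * X) (5 * C) (begin
    6 * X + 6 * c        ≡⟨ *-distribˡ-+ 6 X c ⟨
    6 * (X + c)          ≡⟨ cong (6 *_) C+y≡X+c ⟨
    6 * (C + y)          ≡⟨ regroup C y ⟩
    5 * C + (C + 6 * y)  ≤⟨ +-monoʳ-≤ (5 * C) C+6y≤6c ⟩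
    5 * C + 6 * c        ∎)
    where
    regroup : ∀ C y → 6 * (C + y) ≡ 5 * C + (C + 6 * y)
    regroup = solve-∀
    C+6y≤6c : C + 6 * y ≤ 6 * c
    C+6y≤6c = begin
      C + 6 * y            ≤⟨ +-monoˡ-≤ (6 * y) C≤y+c ⟩
      y + c + 6 * y        ≡⟨ regroup′ y c ⟩
      c + 7 * y            ≤⟨ +-monoʳ-≤ c (*-monoˡ-≤ y (m≤m+n 7 18)) ⟩
      c + 25 * y           ≡⟨ cong (c +_) (*-assoc 5 5 y) ⟩
      c + 5 * (5 * y)      ≤⟨ +-monoʳ-≤ c (*-monoʳ-≤ 5 (<⇒≤ 5y<c)) ⟩
      c + 5 * c            ∎
      where
      regroup′ : ∀ y c → y + c + 6 * y ≡ c + 7 * y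
      regroup′ = solve-∀

module _ {x y d : ℕ} where
  open ≤-Reasoning

  x≤y∧2y≤d⇒6x≤5d : x ≤ y → 2 * y ≤ d → 6 * x ≤ 5 * d
  x≤y∧2y≤d⇒6x≤5d x≤y 2y≤d = begin
    6 * x        ≤⟨ *-monoʳ-≤ 6 x≤y ⟩
    6 * y        ≡⟨ *-assoc 3 2 y ⟩
    3 * (2 * y)  ≤⟨ *-monoʳ-≤ 3 2y≤d ⟩
    3 * d        ≤⟨ *-monoˡ-≤ d (m≤m+n 3 2) ⟩
    5 * d        ∎

  x≤y+1∧2y<d∧d≢1⇒6x≤5d : x ≤ y + 1 → 2 * y < d → d ≢ 1 → 6 * x ≤ 5 * d
  x≤y+1∧2y<d∧d≢1⇒6x≤5d x≤y+1 2y<d d≢1 = begin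
    6 * x                ≤⟨ *-monoʳ-≤ 6 x≤y+1 ⟩
    6 * (y + 1)          ≡⟨ regroup y ⟩
    3 * suc (2 * y) + 3  ≤⟨ +-mono-≤ (*-monoʳ-≤ 3 2y<d) 3≤2d ⟩
    3 * d + 2 * d        ≡⟨ *-distribʳ-+ d 3 2 ⟨
    5 * d                ∎
    where
    regroup : ∀ y → 6 * (y + 1) ≡ 3 * suc (2 * y) + 3
    regroup = solve-∀
    2≤d : 2 ≤ d
    2≤d = ≤∧≢⇒< (≤-<-trans z≤n 2y<d) (d≢1 ∘ ≡.sym)
    3≤2d : 3 ≤ 2 * d
    3≤2d = ≤-trans (n≤1+n 3) (*-monoʳ-≤ 2 2≤d)

record AddsVertex {n} (v : Fin n) (P Q : Fin n → Bool) : Set where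
  field
    absent  : P v ≡ false
    present : Q v ≡ true
    agree   : ∀ {u} → u ≢ v → P u ≡ Q u

  grows : ∀ {u} → P u ≡ true → Q u ≡ true
  grows {u} Pu≡true with u ≟ v
  ... | yes refl = present
  ... | no u≢v   = trans (≡.sym (agree u≢v)) Pu≡true

  shrinks : ∀ {u} → Q u ≡ false → P u ≡ false
  shrinks {u} Qu≡false with u ≟ v
  ... | yes refl = absent
  ... | no u≢v   = trans (agree u≢v) Qu≡false

-- cut G S and cv G S are cutᵖ G (lookup S) and cvᵖ G (lookup S) by definition.
module _ {n} (G : Graph n) where

  leaving : (Fin n → Bool) → Fin n → ℕ
  leaving P u = count λ w → adj G u w ∧ not (P w)

  cutᵖ : (Fin n → Bool) → ℕ
  cutᵖ P = sumF λ u → if P u then leaving P u else 0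

  cvᵖ : (Fin n → Bool) → Fin n → ℕ
  cvᵖ P v = count λ w → adj G v w ∧ (P v xor P w)

  cv-∈ : ∀ {P v} → P v ≡ true → cvᵖ P v ≡ leaving P v
  cv-∈ {P} {v} Pv≡true = count-cong λ w → cong (λ b → adj G v w ∧ (b xor P w)) Pv≡true

  cv-∉ : ∀ {P v} → P v ≡ false → cvᵖ P v ≡ count (λ w → adj G v w ∧ P w)
  cv-∉ {P} {v} Pv≡false = count-cong λ w → cong (λ b → adj G v w ∧ (b xor P w)) Pv≡false

  count-adj-sumF : ∀ (P : Fin n → Bool) v →
                   count (λ w → adj G v w ∧ P w) ≡ sumF (λ u → if P u then 𝟙 (adj G u v) else 0)
  count-adj-sumF P v = trans (count-sumF (λ w → adj G v w ∧ P w)) (sumF-cong term)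
    where
    term : ∀ u → 𝟙 (adj G v u ∧ P u) ≡ (if P u then 𝟙 (adj G u v) else 0)
    term u rewrite sym G v u with P u
    ... | true  = cong 𝟙 (∧-identityʳ _)
    ... | false = cong 𝟙 (∧-zeroʳ _)

  cv≤cut : ∀ {P v} → P v ≡ false → cvᵖ P v ≤ cutᵖ P
  cv≤cut {P} {v} Pv≡false = begin
    cvᵖ P v                                          ≡⟨ cv-∉ Pv≡false ⟩
    count (λ w → adj G v w ∧ P w)                    ≡⟨ count-adj-sumF P v ⟩
    sumF (λ u → if P u then 𝟙 (adj G u v) else 0)    ≤⟨ sumF-mono edge≤leaving ⟩
    cutᵖ P                                           ∎
    where
    open ≤-Reasoning
    edge≤leaving : ∀ u → (if P u then 𝟙 (adj G u v) else 0) ≤ (if P u then leaving P u else 0)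
    edge≤leaving u with P u
    ... | false = z≤n
    ... | true  = ≤-trans (≤-reflexive (cong 𝟙 (≡.sym adj∧notPv))) (𝟙≤count _ v)
      where
      adj∧notPv : adj G u v ∧ not (P v) ≡ adj G u v
      adj∧notPv rewrite Pv≡false = ∧-identityʳ _

  cut-const : ∀ {P} b → (∀ u → P u ≡ b) → cutᵖ P ≡ 0
  cut-const {P} b P≗b = sumF-zero row≡0
    where
    row≡0 : ∀ u → (if P u then leaving P u else 0) ≡ 0
    row≡0 u with P u | P≗b u
    ... | false | _    = refl
    ... | true  | refl = count-zero λ w → trans (cong (λ b → adj G u w ∧ not b) (P≗b w)) (∧-zeroʳ _)

  cv-const : ∀ {P} b v → (∀ u → P u ≡ b) → cvᵖ P v ≡ 0
  cv-const b v P≗b = count-zero λ w →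
    trans (cong₂ (λ x y → adj G v w ∧ (x xor y)) (P≗b v) (P≗b w))
          (trans (cong (adj G v w ∧_) (xor-same b)) (∧-zeroʳ _))

  module _ {v : Fin n} {P Q : Fin n → Bool} (P+v≡Q : AddsVertex v P Q) where
    open AddsVertex P+v≡Q

    leaving-add : ∀ u → leaving P u ≡ leaving Q u + 𝟙 (adj G u v)
    leaving-add u = begin
      leaving P u                                ≡⟨ +-identityʳ _ ⟨
      leaving P u + 0                            ≡⟨ cong (leaving P u +_) (cong 𝟙 adj∧notQv) ⟨
      leaving P u + 𝟙 (adj G u v ∧ not (Q v))    ≡⟨ count-swap-at v (λ w≢v → cong (λ b → adj G u _ ∧ not b) (agree w≢v)) ⟩
      leaving Q u + 𝟙 (adj G u v ∧ not (P v))    ≡⟨ cong (leaving Q u +_) (cong 𝟙 adj∧notPv) ⟩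
      leaving Q u + 𝟙 (adj G u v)                ∎
      where
      open ≡-Reasoning
      adj∧notQv : adj G u v ∧ not (Q v) ≡ false
      adj∧notQv rewrite present = ∧-zeroʳ _
      adj∧notPv : adj G u v ∧ not (P v) ≡ adj G u v
      adj∧notPv rewrite absent = ∧-identityʳ _

    cut-add : cutᵖ Q + cvᵖ P v ≡ cutᵖ P + cvᵖ Q v
    cut-add = begin
      cutᵖ Q + cvᵖ P v                      ≡⟨ cong (cutᵖ Q +_) (trans (cv-∉ absent) (count-adj-sumF P v)) ⟩
      sumF rowQ + sumF toV                  ≡⟨ sumF-+ rowQ toV ⟨
      sumF (λ u → rowQ u + toV u)           ≡⟨ +-identityʳ _ ⟨
      sumF (λ u → rowQ u + toV u) + 0       ≡⟨ cong (sumF (λ u → rowQ u + toV u) +_) rowP-v ⟨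
      sumF (λ u → rowQ u + toV u) + rowP v  ≡⟨ sumF-swap-at v rows-agree ⟩
      sumF rowP + (rowQ v + toV v)          ≡⟨ cong (sumF rowP +_) rowQ+toV-v ⟩
      cutᵖ P + cvᵖ Q v                      ∎
      where
      open ≡-Reasoning
      rowP rowQ toV : Fin n → ℕ
      rowP u = if P u then leaving P u else 0
      rowQ u = if Q u then leaving Q u else 0
      toV  u = if P u then 𝟙 (adj G u v) else 0
      rowP-v : rowP v ≡ 0
      rowP-v rewrite absent = refl
      rowQ+toV-v : rowQ v + toV v ≡ cvᵖ Q v
      rowQ+toV-v rewrite absent =
        trans (+-identityʳ _) (trans (cong (λ b → if b then leaving Q v else 0) present) (≡.sym (cv-∈ present)))
      rows-agree : ∀ {u} → u ≢ v → rowQ u + toV u ≡ rowP u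
      rows-agree {u} u≢v rewrite ≡.sym (agree u≢v) with P u
      ... | true  = ≡.sym (leaving-add u)
      ... | false = refl

    deg-add : deg G v ≡ cvᵖ P v + cvᵖ Q v
    deg-add = begin
      deg G v                                                  ≡⟨ count-+ split ⟩
      count (λ w → adj G v w ∧ P w) + leaving Q v              ≡⟨ cong₂ _+_ (cv-∉ absent) (cv-∈ present) ⟨
      cvᵖ P v + cvᵖ Q v                                        ∎
      where
      open ≡-Reasoning
      split : ∀ w → 𝟙 (adj G v w) ≡ 𝟙 (adj G v w ∧ P w) + 𝟙 (adj G v w ∧ not (Q w))
      split w with w ≟ v
      ... | yes refl rewrite irrefl G w = refl
      ... | no w≢v   rewrite agree w≢v = 𝟙-split (adj G v w) (Q w)

    cv-≤-+1 : ∀ {u} → u ≢ v → cvᵖ P u ≤ cvᵖ Q u + 1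
    cv-≤-+1 {u} u≢v = begin
      cvᵖ P u                               ≤⟨ m≤m+n _ _ ⟩
      cvᵖ P u + 𝟙 (crossing Q v)            ≡⟨ count-swap-at v crossings-agree ⟩
      cvᵖ Q u + 𝟙 (crossing P v)            ≤⟨ +-monoʳ-≤ (cvᵖ Q u) (𝟙≤1 _) ⟩
      cvᵖ Q u + 1                           ∎
      where
      open ≤-Reasoning
      crossing : (Fin n → Bool) → Fin n → Bool
      crossing R w = adj G u w ∧ (R u xor R w)
      crossings-agree : ∀ {w} → w ≢ v → crossing P w ≡ crossing Q w
      crossings-agree w≢v = cong₂ (λ x y → adj G u _ ∧ (x xor y)) (agree u≢v) (agree w≢v)

    cv-mono-∉ : ∀ {u} → Q u ≡ false → cvᵖ P u ≤ cvᵖ Q u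
    cv-mono-∉ {u} Qu≡false = begin
      cvᵖ P u                         ≡⟨ cv-∉ (shrinks Qu≡false) ⟩
      count (λ w → adj G u w ∧ P w)   ≤⟨ count-mono edge-grows ⟩
      count (λ w → adj G u w ∧ Q w)   ≡⟨ cv-∉ Qu≡false ⟨
      cvᵖ Q u                         ∎
      where
      open ≤-Reasoning
      edge-grows : ∀ w → adj G u w ∧ P w ≡ true → adj G u w ∧ Q w ≡ true
      edge-grows w with adj G u w
      ... | true  = grows
      ... | false = λ ()

    cut≤⇒2*cv≤deg : cutᵖ P ≤ cutᵖ Q → 2 * cvᵖ P v ≤ deg G v
    cut≤⇒2*cv≤deg cutP≤cutQ = begin
      2 * cvᵖ P v            ≡⟨ cong (cvᵖ P v +_) (+-identityʳ _) ⟩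
      cvᵖ P v + cvᵖ P v      ≤⟨ +-monoʳ-≤ (cvᵖ P v) cvP≤cvQ ⟩
      cvᵖ P v + cvᵖ Q v      ≡⟨ deg-add ⟨
      deg G v                ∎
      where
      open ≤-Reasoning
      cvP≤cvQ : cvᵖ P v ≤ cvᵖ Q v
      cvP≤cvQ = +-cancelˡ-≤ (cutᵖ Q) _ _ (begin
        cutᵖ Q + cvᵖ P v  ≡⟨ cut-add ⟩
        cutᵖ P + cvᵖ Q v  ≤⟨ +-monoˡ-≤ (cvᵖ Q v) cutP≤cutQ ⟩
        cutᵖ Q + cvᵖ Q v  ∎)

    cut<⇒2*cv<deg : cutᵖ Q < cutᵖ P → 2 * cvᵖ Q v < deg G v
    cut<⇒2*cv<deg cutQ<cutP = begin-strict
      2 * cvᵖ Q v            ≡⟨ cong (cvᵖ Q v +_) (+-identityʳ _) ⟩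
      cvᵖ Q v + cvᵖ Q v      <⟨ +-monoˡ-< (cvᵖ Q v) cvQ<cvP ⟩
      cvᵖ P v + cvᵖ Q v      ≡⟨ deg-add ⟨
      deg G v                ∎
      where
      open ≤-Reasoning
      cvQ<cvP : cvᵖ Q v < cvᵖ P v
      cvQ<cvP = +-cancelˡ-< (cutᵖ Q) _ _ (begin-strict
        cutᵖ Q + cvᵖ Q v  <⟨ +-monoˡ-< (cvᵖ Q v) cutQ<cutP ⟩
        cutᵖ P + cvᵖ Q v  ≡⟨ cut-add ⟨
        cutᵖ Q + cvᵖ P v  ∎)

    cut-add-to-empty : (∀ u → P u ≡ false) → cutᵖ Q ≡ deg G v
    cut-add-to-empty P≗false = begin
      cutᵖ Q                ≡⟨ +-identityʳ _ ⟨
      cutᵖ Q + 0            ≡⟨ cong (cutᵖ Q +_) (cv-const false v P≗false) ⟨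
      cutᵖ Q + cvᵖ P v      ≡⟨ cut-add ⟩
      cutᵖ P + cvᵖ Q v      ≡⟨ cong (_+ cvᵖ Q v) (trans (cut-const false P≗false) (≡.sym (cv-const false v P≗false))) ⟩
      cvᵖ P v + cvᵖ Q v     ≡⟨ deg-add ⟨
      deg G v               ∎
      where open ≡-Reasoning

    cut-remove-from-full : (∀ u → Q u ≡ true) → cutᵖ P ≡ deg G v
    cut-remove-from-full Q≗true = begin
      cutᵖ P                ≡⟨ +-identityʳ _ ⟨
      cutᵖ P + 0            ≡⟨ cong (cutᵖ P +_) (cv-const true v Q≗true) ⟨
      cutᵖ P + cvᵖ Q v      ≡⟨ cut-add ⟨
      cutᵖ Q + cvᵖ P v      ≡⟨ cong (_+ cvᵖ P v) (cut-const true Q≗true) ⟩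
      cvᵖ P v               ≡⟨ +-identityʳ _ ⟨
      cvᵖ P v + 0           ≡⟨ cong (cvᵖ P v +_) (cv-const true v Q≗true) ⟨
      cvᵖ P v + cvᵖ Q v     ≡⟨ deg-add ⟨
      deg G v               ∎
      where open ≡-Reasoning

module _ {n : ℕ} where

  lookup-∉ : ∀ {p : Subset n} {x} → x ∉ p → lookup p x ≡ false
  lookup-∉ {p} {x} x∉p = ¬-not (x∉p ∘ lookup⇒[]= x p)

  lookup-cong-∈ : ∀ {p q : Subset n} {x} → (x ∈ p → x ∈ q) → (x ∈ q → x ∈ p) → lookup p x ≡ lookup q x
  lookup-cong-∈ {p} {q} {x} p⇒q q⇒p with x ∈? p
  ... | yes x∈p = trans ([]=⇒lookup x∈p) (≡.sym ([]=⇒lookup (p⇒q x∈p)))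
  ... | no  x∉p = trans (lookup-∉ x∉p) (≡.sym (lookup-∉ (x∉p ∘ q⇒p)))

  addsVertex-∈ : ∀ {p q : Subset n} {x} → x ∉ p → x ∈ q →
                 (∀ {u} → u ≢ x → u ∈ p → u ∈ q) → (∀ {u} → u ≢ x → u ∈ q → u ∈ p) →
                 AddsVertex x (lookup p) (lookup q)
  addsVertex-∈ x∉p x∈q p⇒q q⇒p = record
    { absent  = lookup-∉ x∉p
    ; present = []=⇒lookup x∈q
    ; agree   = λ u≢x → lookup-cong-∈ (p⇒q u≢x) (q⇒p u≢x)
    }

x∉p-x : ∀ {n} (p : Subset n) x → x ∉ p - x
x∉p-x (_ ∷ p) zero    ()
x∉p-x (_ ∷ p) (suc x) (there x∈p-x) = x∉p-x p x x∈p-x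

module _ {n : ℕ} {x : Fin n} where

  remove-addsVertex : ∀ {p} → x ∈ p → AddsVertex x (lookup (p - x)) (lookup p)
  remove-addsVertex {p} x∈p = addsVertex-∈ (x∉p-x p x) x∈p (λ _ → p─q⊆p p ⁅ x ⁆) (λ u≢x u∈p → x∈p∧x≢y⇒x∈p-y u∈p u≢x)

  insert-addsVertex : ∀ {p} → x ∉ p → AddsVertex x (lookup p) (lookup (p ∪ ⁅ x ⁆))
  insert-addsVertex {p} x∉p = addsVertex-∈ x∉p (x∈p∪q⁺ (inj₂ (x∈⁅x⁆ x))) (λ _ → x∈p∪q⁺ ∘ inj₁) back
    where
    back : ∀ {u} → u ≢ x → u ∈ p ∪ ⁅ x ⁆ → u ∈ p
    back u≢x u∈p∪x = [ id , (λ u∈x → contradiction (x∈⁅y⁆⇒x≡y x u∈x) u≢x) ]′ (x∈p∪q⁻ p ⁅ x ⁆ u∈p∪x)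

  singleton-addsVertex : AddsVertex x (lookup ⊥) (lookup ⁅ x ⁆)
  singleton-addsVertex = addsVertex-∈ ∉⊥ (x∈⁅x⁆ x) (λ _ u∈⊥ → contradiction u∈⊥ ∉⊥)
                                      (λ u≢x u∈x → contradiction (x∈⁅y⁆⇒x≡y x u∈x) u≢x)

module MinimumCut {n} (G : Graph n) (s t : Fin n) (S : Subset n) (S-min : IsMinCut G s t S) where
  private
    s∈S : s ∈ S
    s∈S = proj₁ S-min
    t∉S : t ∉ S
    t∉S = proj₁ (proj₂ S-min)
    minimum : ∀ S′ → s ∈ S′ → t ∉ S′ → cut G S ≤ cut G S′
    minimum = proj₂ (proj₂ S-min)
    S-s+s : AddsVertex s (lookup (S - s)) (lookup S)
    S-s+s = remove-addsVertex s∈S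
    y c : ℕ
    y = cv G (S - s) s
    c = cv G S s
    open ≤-Reasoning

  s≢t : s ≢ t
  s≢t refl = t∉S s∈S

  cut≤deg-source : cut G S ≤ deg G s
  cut≤deg-source = begin
    cut G S      ≤⟨ minimum ⁅ s ⁆ (x∈⁅x⁆ s) (x≢y⇒x∉⁅y⁆ (s≢t ∘ ≡.sym)) ⟩
    cut G ⁅ s ⁆  ≡⟨ cut-add-to-empty G singleton-addsVertex (λ u → lookup-replicate u false) ⟩
    deg G s      ∎

  cut≤deg-sink : cut G S ≤ deg G t
  cut≤deg-sink = begin
    cut G S        ≤⟨ minimum (⊤ - t) (x∈p∧x≢y⇒x∈p-y ∈⊤ s≢t) (x∉p-x ⊤ t) ⟩
    cut G (⊤ - t)  ≡⟨ cut-remove-from-full G (remove-addsVertex ∈⊤) (λ u → lookup-replicate u true) ⟩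
    deg G t        ∎

  2*cv≤deg-outside : ∀ {u} → u ∉ S → u ≢ t → 2 * cv G S u ≤ deg G u
  2*cv≤deg-outside {u} u∉S u≢t =
    cut≤⇒2*cv≤deg G (insert-addsVertex u∉S) (minimum (S ∪ ⁅ u ⁆) (x∈p∪q⁺ (inj₁ s∈S)) t∉S∪u)
    where
    t∉S∪u : t ∉ S ∪ ⁅ u ⁆
    t∉S∪u t∈S∪u = [ t∉S , (λ t∈u → u≢t (≡.sym (x∈⁅y⁆⇒x≡y u t∈u))) ]′ (x∈p∪q⁻ S ⁅ u ⁆ t∈S∪u)

  2*cv<deg-inside : (∀ S′ → S′ ⊂ S → s ∈ S′ → cut G S < cut G S′) →
                    ∀ {u} → u ∈ S → u ≢ s → 2 * cv G S u < deg G u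
  2*cv<deg-inside minimal {u} u∈S u≢s =
    cut<⇒2*cv<deg G (remove-addsVertex u∈S) (minimal (S - u) (x∈p⇒p-x⊂p u∈S) (x∈p∧x≢y⇒x∈p-y s∈S (u≢s ∘ ≡.sym)))

  cut-minus-source≤2*deg : cut G (S - s) ≤ 2 * deg G s
  cut-minus-source≤2*deg = C+y≡X+c∧C≤d∧y≤d⇒X≤2d {y = y} {c} (cut-add G S-s+s) cut≤deg-source y≤deg
    where
    y≤deg : y ≤ deg G s
    y≤deg = ≤-trans (m≤m+n y c) (≤-reflexive (≡.sym (deg-add G S-s+s)))

  friendly-outside : ∀ {u} → u ∉ S → u ≢ t → FriendlinessAtLeastSixth G (S - s) u
  friendly-outside u∉S u≢t = x≤y∧2y≤d⇒6x≤5d (cv-mono-∉ G S-s+s (lookup-∉ u∉S)) (2*cv≤deg-outside u∉S u≢t)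

  friendly-inside : (∀ S′ → S′ ⊂ S → s ∈ S′ → cut G S < cut G S′) →
                    ∀ {u} → u ∈ S → u ≢ s → deg G u ≢ 1 → FriendlinessAtLeastSixth G (S - s) u
  friendly-inside minimal u∈S u≢s =
    x≤y+1∧2y<d∧d≢1⇒6x≤5d (cv-≤-+1 G S-s+s u≢s) (2*cv<deg-inside minimal u∈S u≢s)

  module _ (s-unfriendly : FriendlinessBelowSixth G S s) where

    friendly-source : FriendlinessAtLeastSixth G (S - s) s
    friendly-source = d≡y+c∧5d<6c⇒6y≤5d {y = y} {c} (deg-add G S-s+s) s-unfriendly

    6*cut-minus-source≤5*cut : 6 * cut G (S - s) ≤ 5 * cut G S
    6*cut-minus-source≤5*cut = C+y≡X+c∧C≤y+c∧5y<c⇒6X≤5C {y = y} {c} (cut-add G S-s+s)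
      (≤-trans cut≤deg-source (≤-reflexive (deg-add G S-s+s)))
      (d≡y+c∧5d<6c⇒5y<c {y = y} {c} (deg-add G S-s+s) s-unfriendly)

    friendly-sink : FriendlinessAtLeastSixth G (S - s) t
    friendly-sink = begin
      6 * cv G (S - s) t  ≤⟨ *-monoʳ-≤ 6 (cv≤cut G (lookup-∉ (t∉S ∘ p─q⊆p S ⁅ s ⁆))) ⟩
      6 * cut G (S - s)   ≤⟨ 6*cut-minus-source≤5*cut ⟩
      5 * cut G S         ≤⟨ *-monoʳ-≤ 5 cut≤deg-sink ⟩
      5 * deg G t         ∎

lemma3p4 : ∀ {n : ℕ} (G : Graph n) (s t : Fin n) (S : Subset n)
    → (∀ (v : Fin n) → deg G v ≢ 1)
    → IsMinimalMinCut G s t S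
    → FriendlinessBelowSixth G S s
    → SixthFriendly G (S - s) × cut G (S - s) ≤ 2 * deg G s
lemma3p4 G s t S deg≢1 (S-min , minimal) s-unfriendly = friendly , cut-minus-source≤2*deg
  where
  open MinimumCut G s t S S-min
  friendly : SixthFriendly G (S - s)
  friendly u with u ≟ s | u ≟ t | u ∈? S
  ... | yes refl | _        | _       = friendly-source s-unfriendly
  ... | no _     | yes refl | _       = friendly-sink s-unfriendly
  ... | no u≢s   | no _     | yes u∈S = friendly-inside minimal u∈S u≢s (deg≢1 u)
  ... | no _     | no u≢t   | no u∉S  = friendly-outside u∉S u≢t
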